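{- Let $q$ be a power of an odd prime, let $X_1,\dots,X_4$ be homogeneous coordinates of ${\rm PG}(3,q)$ and $U_3=(0,0,1,0)$. For $\lambda\in{\rm GF}(q)$ let $\mathcal Q_\lambda$ be the quadric $X_1X_3-X_2^2+\lambda X_4^2=0$, let $\pi$ be the plane $X_4=0$, and let $\mathcal C=\{(1,t,t^2,0): t\in{\rm GF}(q)\}\cup\{U_3\}$. Then every line of ${\rm PG}(3,q)$ not contained in $\pi$ and containing no point of $\mathcal C$ is tangent to exactly one of the quadrics $\mathcal Q_\lambda$, $\lambda\in{\rm GF}(q)$.
   Context: A line is tangent to a quadric if it is not contained in it and meets it in exactly one point. -}

module Defs where

open import Data.Nat using (ℕ)
open import Data.Fin using (Fin; zero; suc)
open import Data.Sum using (_⊎_)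
open import Data.Product using (Σ; ∃; ∃-syntax; _×_; _,_)
open import Relation.Binary.PropositionalEquality using (_≡_; _≢_)
open import Relation.Binary.Definitions using (DecidableEquality)
open import Relation.Nullary using (¬_)
open import Function.Bundles using (_↔_)
open import Algebra.Structures using (IsCommutativeRing)

record FiniteField (q : ℕ) : Set₁ where
  infixl 6 _+_ _-_
  infixl 7 _*_
  field
    Carrier : Set
    _+_ _*_ : Carrier → Carrier → Carrier
    -_      : Carrier → Carrier
    0# 1#   : Carrier
    isCommutativeRing : IsCommutativeRing _≡_ _+_ _*_ -_ 0# 1#
    0≢1     : 0# ≢ 1#
    inverse : ∀ x → x ≢ 0# → ∃[ y ] (x * y ≡ 1#)
    _≟_     : DecidableEquality Carrier
    enumeration : Fin q ↔ Carrier
  _-_ : Carrier → Carrier → Carrier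
  x - y = x + (- y)

-- Geometry of PG(3,q) over a finite field F.
-- Points: nonzero vectors in F^4 (coordinates X1..X4 = indices 0..3), up to
-- nonzero scalars. Lines: spans of two linearly independent vectors.
module PG3 {q : ℕ} (F : FiniteField q) where
  open FiniteField F

  Vec4 : Set
  Vec4 = Fin 4 → Carrier

  vec : Carrier → Carrier → Carrier → Carrier → Vec4
  vec a b c d zero = a
  vec a b c d (suc zero) = b
  vec a b c d (suc (suc zero)) = c
  vec a b c d (suc (suc (suc zero))) = d

  NonZero : Vec4 → Set
  NonZero v = ∃[ i ] (v i ≢ 0#)

  _∼_ : Vec4 → Vec4 → Set
  v ∼ w = ∃[ c ] (c ≢ 0# × (∀ i → v i ≡ c * w i))

  LinIndep : Vec4 → Vec4 → Set
  LinIndep u v = ∀ a b → (∀ i → a * u i + b * v i ≡ 0#) → (a ≡ 0# × b ≡ 0#)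

  OnLine : Vec4 → Vec4 → Vec4 → Set
  OnLine u v p = NonZero p × ∃[ a ] ∃[ b ] (∀ i → p i ≡ a * u i + b * v i)

  U3 : Vec4
  U3 = vec 0# 0# 1# 0#

  InC : Vec4 → Set
  InC p = (∃[ t ] (p ∼ vec 1# t (t * t) 0#)) ⊎ (p ∼ U3)

  InQ : Carrier → Vec4 → Set
  InQ λ' p = p zero * p (suc (suc zero)) - p (suc zero) * p (suc zero)
             + λ' * p (suc (suc (suc zero))) * p (suc (suc (suc zero))) ≡ 0#

  NotInπ : Vec4 → Vec4 → Set
  NotInπ u v = ∃[ p ] (OnLine u v p × p (suc (suc (suc zero))) ≢ 0#)

  MissesC : Vec4 → Vec4 → Set
  MissesC u v = ∀ p → OnLine u v p → ¬ InC p

  Tangent : Carrier → Vec4 → Vec4 → Set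
  Tangent λ' u v =
    (∃[ p ] (OnLine u v p × ¬ InQ λ' p)) ×
    (∃[ p ] (OnLine u v p × InQ λ' p × (∀ r → OnLine u v r → InQ λ' r → r ∼ p)))

module Submission where

-- Let ℓ be a line spanned by independent u, v, with ℓ ⊄ π and ℓ ∩ C = ∅.
-- Writing points of ℓ as x u + y v, the quadric Q_λ restricts to a binary
-- quadratic form f_λ = A(λ) x² + E(λ) xy + C(λ) y², and (char F ≠ 2 because
-- q is odd) ℓ is tangent to Q_λ exactly when f_λ has one projective zero,
-- i.e. when its discriminant Δ(λ) = E(λ)² - 4 A(λ) C(λ) vanishes.  Let
-- P = v₄ u - u₄ v be the point ℓ ∩ π; then Δ(λ) = Δ(0) - 4 λ Q(P), and
-- Q(P) ≠ 0 because the points of π on the quadrics form exactly the conic C,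
-- which ℓ misses.  So Δ is affine in λ with nonzero slope and vanishes for
-- exactly one λ.

open import Defs
open import Data.Nat using (ℕ)
open import Data.Nat.Divisibility using (_∣_)
open import Data.Nat.Primality using (Prime)
open import Data.Product using (∃-syntax; _×_)
open import Relation.Nullary using (¬_)
open import Relation.Binary.PropositionalEquality using (_≡_)

open import Data.Nat as ℕ using (zero; suc)
open import Data.Fin using (Fin; zero; suc)
open import Data.Product using (_,_; proj₁; proj₂)
open import Data.Sum using (_⊎_; inj₁; inj₂)
open import Data.Empty using (⊥; ⊥-elim)
open import Relation.Nullary using (Dec; yes; no)
open import Relation.Binary.PropositionalEquality
  using (_≢_; refl; sym; trans; cong; cong₂; subst; module ≡-Reasoning)

module Parity where
  open import Data.Nat.Properties using (+-0-commutativeMonoid; *-comm; +-identityʳ)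
  open import Data.Nat.Divisibility using (divides; ∣1⇒≡1)
  open import Data.Nat.Primality using (prime[2]; euclidsLemma)
  open import Data.Fin.Properties using (_<?_; <-asym; <-cmp)
  open import Data.Fin.Permutation using (permutation)
  open import Relation.Binary.Definitions using (tri<; tri≈; tri>)
  open import Algebra.Properties.CommutativeMonoid.Sum +-0-commutativeMonoid
    using (sum; ∑-permute; ∑-distrib-+; sum-cong-≗)

  indicator : ∀ {P : Set} → Dec P → ℕ
  indicator (yes _) = 1
  indicator (no _)  = 0

  exactly-one-smaller : ∀ {n} (i j : Fin n) → i ≢ j →
                        indicator (i <? j) ℕ.+ indicator (j <? i) ≡ 1
  exactly-one-smaller i j i≢j with i <? j | j <? i
  ... | yes i<j | yes j<i = ⊥-elim (<-asym i<j j<i)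
  ... | yes _   | no _    = refl
  ... | no _    | yes _   = refl
  ... | no i≮j  | no j≮i with <-cmp i j
  ... | tri< i<j _ _ = ⊥-elim (i≮j i<j)
  ... | tri≈ _ i≡j _ = ⊥-elim (i≢j i≡j)
  ... | tri> _ _ j<i = ⊥-elim (j≮i j<i)

  sum-ones : ∀ n → sum {n} (λ _ → 1) ≡ n
  sum-ones zero    = refl
  sum-ones (suc n) = cong suc (sum-ones n)

  -- A fixed-point-free involution σ of an n-element set forces n to be even:
  -- with χ i = [i < σ i] every i has χ i + χ (σ i) = 1, and summing over i
  -- counts Σ χ twice because σ permutes the index set.
  fixed-point-free-involution⇒even : ∀ n (σ : Fin n → Fin n) →
    (∀ i → σ (σ i) ≡ i) → (∀ i → σ i ≢ i) → 2 ∣ n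
  fixed-point-free-involution⇒even n σ involutive no-fixed-point = divides (sum χ) n≡Σχ*2
    where
    χ : Fin n → ℕ
    χ i = indicator (i <? σ i)

    pair-sum : ∀ i → 1 ≡ χ i ℕ.+ χ (σ i)
    pair-sum i = sym (trans (cong (λ k → χ i ℕ.+ indicator (σ i <? k)) (involutive i))
                            (exactly-one-smaller i (σ i) (λ e → no-fixed-point i (sym e))))

    n≡Σχ*2 : n ≡ sum χ ℕ.* 2
    n≡Σχ*2 = begin
      n                               ≡⟨ sym (sum-ones n) ⟩
      sum {n} (λ _ → 1)               ≡⟨ sum-cong-≗ pair-sum ⟩
      sum (λ i → χ i ℕ.+ χ (σ i))     ≡⟨ ∑-distrib-+ χ (λ i → χ (σ i)) ⟩
      sum χ ℕ.+ sum (λ i → χ (σ i))   ≡⟨ cong (sum χ ℕ.+_) (sym (∑-permute χ (permutation σ σ involutive involutive))) ⟩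
      sum χ ℕ.+ sum χ                 ≡⟨ cong (sum χ ℕ.+_) (sym (+-identityʳ (sum χ))) ⟩
      2 ℕ.* sum χ                     ≡⟨ *-comm 2 (sum χ) ⟩
      sum χ ℕ.* 2                     ∎
      where open ≡-Reasoning

  odd-power : ∀ p k → ¬ (2 ∣ p) → ¬ (2 ∣ p ℕ.^ k)
  odd-power p zero    _   2∣1 with ∣1⇒≡1 2∣1
  ... | ()
  odd-power p (suc k) 2∤p 2∣p^[k+1] with euclidsLemma p (p ℕ.^ k) prime[2] 2∣p^[k+1]
  ... | inj₁ 2∣p   = 2∤p 2∣p
  ... | inj₂ 2∣p^k = odd-power p k 2∤p 2∣p^k

-- A ring solver for the field F with integer coefficients: both sides of an
-- equation are normalised as polynomials over ℤ, interpreted in F through the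
-- ring homomorphism int : ℤ → F.  (The library's reflective solver uses F
-- itself as coefficient ring and so cannot prove identities such as
-- (x + 1) - x = 1 over an abstract field.)

module FieldSolver {q : ℕ} (F : FiniteField q) where
  open FiniteField F
  open import Data.Integer as ℤ using (ℤ; -[1+_]; _⊖_; _◃_; sign; ∣_∣)
  import Data.Integer.Properties as ℤₚ
  import Data.Nat.Properties as ℕₚ
  open import Data.Sign as Sign using (Sign)
  open import Data.Bool using (Bool; true; false; T)
  open import Data.Maybe using (nothing)
  open import Data.Vec using (Vec)
  open import Algebra.Bundles using (CommutativeRing)
  open import Relation.Binary.PropositionalEquality using (setoid)
  open import Tactic.RingSolver.Core.AlmostCommutativeRing using (AlmostCommutativeRing; fromCommutativeRing)
  open import Tactic.RingSolver.Core.Polynomial.Parameters using (Homomorphism)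
  open import Tactic.RingSolver.Core.Expression using (Expr; Κ; Ι; _⊕_; _⊗_; ⊝_; _⊛_; module Eval)

  private
    commutativeRing : CommutativeRing _ _
    commutativeRing = record { isCommutativeRing = isCommutativeRing }

    open CommutativeRing commutativeRing
      using (ring; +-commutativeSemigroup; +-abelianGroup; +-comm; +-identityˡ; +-identityʳ; -‿inverseʳ)
    open import Algebra.Properties.Ring ring using (-‿distribˡ-*; -‿distribʳ-*; -‿involutive; -0#≈0#)
    open import Algebra.Properties.AbelianGroup +-abelianGroup using (⁻¹-∙-comm)
    open import Algebra.Properties.CommutativeSemigroup +-commutativeSemigroup using (interchange)
    open import Algebra.Properties.Semiring.Mult.TCOptimised (CommutativeRing.semiring commutativeRing)
      using (×-homo-+; ×1-homo-*) renaming (_×_ to _×′_)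

    -- the canonical map ℕ → F, chosen so that 2 ↦ 1# + 1# definitionally
    nat : ℕ → Carrier
    nat n = n ×′ 1#

    sgn : Sign → Carrier → Carrier
    sgn Sign.+ x = x
    sgn Sign.- x = - x

    int : ℤ → Carrier
    int i = sgn (sign i) (nat ∣ i ∣)

    int-◃ : ∀ s n → int (s ◃ n) ≡ sgn s (nat n)
    int-◃ Sign.+ zero    = refl
    int-◃ Sign.- zero    = sym -0#≈0#
    int-◃ Sign.+ (suc n) = refl
    int-◃ Sign.- (suc n) = refl

    sgn-* : ∀ s t x y → sgn (s Sign.* t) (x * y) ≡ sgn s x * sgn t y
    sgn-* Sign.+ Sign.+ x y = refl
    sgn-* Sign.+ Sign.- x y = -‿distribʳ-* x y
    sgn-* Sign.- Sign.+ x y = -‿distribˡ-* x y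
    sgn-* Sign.- Sign.- x y = begin
      x * y               ≡⟨ sym (-‿involutive (x * y)) ⟩
      - - (x * y)         ≡⟨ cong -_ (-‿distribʳ-* x y) ⟩
      - (x * - y)         ≡⟨ -‿distribˡ-* x (- y) ⟩
      - x * - y           ∎
      where open ≡-Reasoning

    int-* : ∀ i j → int (i ℤ.* j) ≡ int i * int j
    int-* i j = begin
      int (sign i Sign.* sign j ◃ ∣ i ∣ ℕ.* ∣ j ∣)            ≡⟨ int-◃ (sign i Sign.* sign j) (∣ i ∣ ℕ.* ∣ j ∣) ⟩
      sgn (sign i Sign.* sign j) (nat (∣ i ∣ ℕ.* ∣ j ∣))       ≡⟨ cong (sgn (sign i Sign.* sign j)) (×1-homo-* ∣ i ∣ ∣ j ∣) ⟩
      sgn (sign i Sign.* sign j) (nat ∣ i ∣ * nat ∣ j ∣)       ≡⟨ sgn-* (sign i) (sign j) _ _ ⟩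
      int i * int j                                           ∎
      where open ≡-Reasoning

    nat-suc : ∀ n → nat (suc n) ≡ 1# + nat n
    nat-suc = ×-homo-+ 1# 1

    int-⊖ : ∀ m n → int (m ⊖ n) ≡ nat m - nat n
    int-⊖ m       zero    = sym (trans (cong (nat m +_) -0#≈0#) (+-identityʳ _))
    int-⊖ zero    (suc n) = sym (+-identityˡ _)
    int-⊖ (suc m) (suc n) = begin
      int (suc m ⊖ suc n)                  ≡⟨ cong int (ℤₚ.[1+m]⊖[1+n]≡m⊖n m n) ⟩
      int (m ⊖ n)                          ≡⟨ int-⊖ m n ⟩
      nat m - nat n                        ≡⟨ sym (+-identityˡ _) ⟩
      0# + (nat m - nat n)                 ≡⟨ cong (_+ (nat m - nat n)) (sym (-‿inverseʳ 1#)) ⟩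
      (1# - 1#) + (nat m - nat n)          ≡⟨ interchange 1# (- 1#) (nat m) (- nat n) ⟩
      (1# + nat m) + (- 1# + - nat n)      ≡⟨ cong ((1# + nat m) +_) (⁻¹-∙-comm 1# (nat n)) ⟩
      (1# + nat m) - (1# + nat n)          ≡⟨ sym (cong₂ _-_ (nat-suc m) (nat-suc n)) ⟩
      nat (suc m) - nat (suc n)            ∎
      where open ≡-Reasoning

    int-+ : ∀ i j → int (i ℤ.+ j) ≡ int i + int j
    int-+ (ℤ.+ m)  (ℤ.+ n)  = ×-homo-+ 1# m n
    int-+ (ℤ.+ m)  -[1+ n ] = int-⊖ m (suc n)
    int-+ -[1+ m ] (ℤ.+ n)  = trans (int-⊖ n (suc m)) (+-comm _ _)
    int-+ -[1+ m ] -[1+ n ] = begin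
      - nat (suc (suc (m ℕ.+ n)))          ≡⟨ cong (λ k → - nat (suc k)) (sym (ℕₚ.+-suc m n)) ⟩
      - nat (suc m ℕ.+ suc n)              ≡⟨ cong -_ (×-homo-+ 1# (suc m) (suc n)) ⟩
      - (nat (suc m) + nat (suc n))        ≡⟨ sym (⁻¹-∙-comm _ _) ⟩
      - nat (suc m) + - nat (suc n)        ∎
      where open ≡-Reasoning

    int-- : ∀ i → int (ℤ.- i) ≡ - int i
    int-- -[1+ n ]      = sym (-‿involutive _)
    int-- (ℤ.+ zero)    = sym -0#≈0#
    int-- (ℤ.+ suc n)   = refl

    isZero : ℤ → Bool
    isZero (ℤ.+ zero) = true
    isZero _          = false

    isZero-sound : ∀ i → T (isZero i) → 0# ≡ int i
    isZero-sound (ℤ.+ zero) _ = refl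

    homomorphism : Homomorphism _ _ _ _
    homomorphism = record
      { from = record { rawRing = CommutativeRing.rawRing ℤₚ.+-*-commutativeRing ; isZero = isZero }
      ; to = fromCommutativeRing commutativeRing (λ _ → nothing)
      ; morphism = record
        { ⟦_⟧ = int ; +-homo = int-+ ; *-homo = int-* ; -‿homo = int--
        ; 0-homo = refl ; 1-homo = refl }
      ; Zero-C⟶Zero-R = isZero-sound
      }

    open Eval (AlmostCommutativeRing.rawRing (Homomorphism.to homomorphism)) int
    open import Tactic.RingSolver.Core.Polynomial.Base (Homomorphism.from homomorphism)
    open import Tactic.RingSolver.Core.Polynomial.Semantics homomorphism renaming (⟦_⟧ to ⟦_⟧ₚ)
    open import Tactic.RingSolver.Core.Polynomial.Homomorphism homomorphism
    open import Algebra.Definitions.RawSemiring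
      (AlmostCommutativeRing.rawSemiring (Homomorphism.to homomorphism)) using (_^′_)

    normalise : ∀ {n} → Expr ℤ n → Poly n
    normalise (Κ x)   = κ x
    normalise (Ι x)   = ι x
    normalise (x ⊕ y) = normalise x ⊞ normalise y
    normalise (x ⊗ y) = normalise x ⊠ normalise y
    normalise (⊝ x)   = ⊟ normalise x
    normalise (x ⊛ i) = normalise x ⊡ i

    ⟦_⇓⟧ : ∀ {n} → Expr ℤ n → Vec Carrier n → Carrier
    ⟦ e ⇓⟧ = ⟦ normalise e ⟧ₚ

    correct : ∀ {n} (e : Expr ℤ n) ρ → ⟦ e ⇓⟧ ρ ≡ ⟦ e ⟧ ρ
    correct (Κ x)   ρ = κ-hom x ρ
    correct (Ι x)   ρ = ι-hom x ρ
    correct (x ⊕ y) ρ = trans (⊞-hom (normalise x) (normalise y) ρ) (cong₂ _+_ (correct x ρ) (correct y ρ))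
    correct (x ⊗ y) ρ = trans (⊠-hom (normalise x) (normalise y) ρ) (cong₂ _*_ (correct x ρ) (correct y ρ))
    correct (⊝ x)   ρ = trans (⊟-hom (normalise x) ρ) (cong -_ (correct x ρ))
    correct (x ⊛ i) ρ = trans (⊡-hom (normalise x) i ρ) (cong (_^′ i) (correct x ρ))

  open import Relation.Binary.Reflection (setoid Carrier) Ι ⟦_⟧ ⟦_⇓⟧ correct public using (solve)

  infixl 6 _:+_ _:-_
  infixl 7 _:*_
  infix  8 :-_ #_
  infix  4 _:=_

  _:+_ _:*_ _:-_ : ∀ {n} → Expr ℤ n → Expr ℤ n → Expr ℤ n
  _:+_ = _⊕_
  _:*_ = _⊗_
  x :- y = x ⊕ (⊝ y)

  :-_ : ∀ {n} → Expr ℤ n → Expr ℤ n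
  :-_ = ⊝_

  #_ : ∀ {n} → ℕ → Expr ℤ n
  # k = Κ (ℤ.+ k)

  _:=_ : ∀ {n} → Expr ℤ n → Expr ℤ n → Expr ℤ n × Expr ℤ n
  _:=_ = _,_


module FieldFacts {q : ℕ} (F : FiniteField q) where
  open FiniteField F
  open FieldSolver F
  open import Function.Bundles using (Inverse)
  open Parity using (fixed-point-free-involution⇒even)

  two : Carrier
  two = 1# + 1#

  difference-zero : ∀ {a b} → a - b ≡ 0# → a ≡ b
  difference-zero {a} {b} a-b≡0 = begin
    a            ≡⟨ solve 2 (λ a b → a := (a :- b) :+ b) refl a b ⟩
    (a - b) + b  ≡⟨ cong (_+ b) a-b≡0 ⟩
    0# + b       ≡⟨ solve 1 (λ b → # 0 :+ b := b) refl b ⟩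
    b            ∎
    where open ≡-Reasoning

  times-unit : ∀ {k k⁻¹} → k * k⁻¹ ≡ 1# → ∀ x → x * (k * k⁻¹) ≡ x
  times-unit kk⁻¹≡1 x = trans (cong (x *_) kk⁻¹≡1) (solve 1 (λ x → x :* # 1 := x) refl x)

  zero-product : ∀ {a b} → a * b ≡ 0# → a ≡ 0# ⊎ b ≡ 0#
  zero-product {a} {b} ab≡0 with a ≟ 0#
  ... | yes a≡0 = inj₁ a≡0
  ... | no  a≢0 with inverse a a≢0
  ... | a⁻¹ , aa⁻¹≡1 = inj₂ (begin
    b              ≡⟨ sym (times-unit aa⁻¹≡1 b) ⟩
    b * (a * a⁻¹)  ≡⟨ solve 3 (λ a b t → b :* (a :* t) := t :* (a :* b)) refl a b a⁻¹ ⟩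
    a⁻¹ * (a * b)  ≡⟨ cong (a⁻¹ *_) ab≡0 ⟩
    a⁻¹ * 0#       ≡⟨ solve 1 (λ t → t :* # 0 := # 0) refl a⁻¹ ⟩
    0#             ∎)
    where open ≡-Reasoning

  product-nonzero : ∀ {a b} → a ≢ 0# → b ≢ 0# → a * b ≢ 0#
  product-nonzero a≢0 b≢0 ab≡0 with zero-product ab≡0
  ... | inj₁ a≡0 = a≢0 a≡0
  ... | inj₂ b≡0 = b≢0 b≡0

  cancel-factor : ∀ {a b} → a * b ≡ 0# → b ≢ 0# → a ≡ 0#
  cancel-factor ab≡0 b≢0 with zero-product ab≡0
  ... | inj₁ a≡0 = a≡0
  ... | inj₂ b≡0 = ⊥-elim (b≢0 b≡0)

  negation-nonzero : ∀ {a} → a ≢ 0# → - a ≢ 0#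
  negation-nonzero {a} a≢0 -a≡0 = a≢0 (begin
    a       ≡⟨ solve 1 (λ a → a := :- (:- a)) refl a ⟩
    - - a   ≡⟨ cong -_ -a≡0 ⟩
    - 0#    ≡⟨ solve 0 (:- # 0 := # 0) refl ⟩
    0#      ∎)
    where open ≡-Reasoning

  square-zero : ∀ {a} → a * a ≡ 0# → a ≡ 0#
  square-zero aa≡0 with zero-product aa≡0
  ... | inj₁ a≡0 = a≡0
  ... | inj₂ a≡0 = a≡0

  -- In characteristic 2 the translation x ↦ x + 1 is a fixed-point-free
  -- involution of F, so the order q is even.
  characteristic-two⇒even-order : two ≡ 0# → 2 ∣ q
  characteristic-two⇒even-order 1+1≡0 =
    fixed-point-free-involution⇒even q σ involutive no-fixed-point
    where
    open Inverse enumeration using (to; from; strictlyInverseˡ; strictlyInverseʳ)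

    σ : Fin q → Fin q
    σ i = from (to i + 1#)

    involutive : ∀ i → σ (σ i) ≡ i
    involutive i = begin
      from (to (from (to i + 1#)) + 1#)  ≡⟨ cong (λ z → from (z + 1#)) (strictlyInverseˡ (to i + 1#)) ⟩
      from ((to i + 1#) + 1#)            ≡⟨ cong from (solve 1 (λ x → (x :+ # 1) :+ # 1 := x :+ (# 1 :+ # 1)) refl (to i)) ⟩
      from (to i + two)                  ≡⟨ cong (λ z → from (to i + z)) 1+1≡0 ⟩
      from (to i + 0#)                   ≡⟨ cong from (solve 1 (λ x → x :+ # 0 := x) refl (to i)) ⟩
      from (to i)                        ≡⟨ strictlyInverseʳ i ⟩
      i                                  ∎
      where open ≡-Reasoning

    no-fixed-point : ∀ i → σ i ≢ i
    no-fixed-point i σi≡i = 0≢1 (sym (begin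
      1#                 ≡⟨ solve 1 (λ x → # 1 := (x :+ # 1) :- x) refl (to i) ⟩
      (to i + 1#) - to i ≡⟨ cong (_- to i) (trans (sym (strictlyInverseˡ (to i + 1#))) (cong to σi≡i)) ⟩
      to i - to i        ≡⟨ solve 1 (λ x → x :- x := # 0) refl (to i) ⟩
      0#                 ∎))
      where open ≡-Reasoning

  odd-order⇒two≢0 : ¬ (2 ∣ q) → two ≢ 0#
  odd-order⇒two≢0 2∤q 1+1≡0 = 2∤q (characteristic-two⇒even-order 1+1≡0)

  affine-unique-solution : ∀ d k → k ≢ 0# →
    ∃[ λ' ] (d - λ' * k ≡ 0# × (∀ μ → d - μ * k ≡ 0# → μ ≡ λ'))
  affine-unique-solution d k k≢0 with inverse k k≢0
  ... | k⁻¹ , kk⁻¹≡1 = d * k⁻¹ , solves , unique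
    where
    open ≡-Reasoning
    solves : d - d * k⁻¹ * k ≡ 0#
    solves = begin
      d - d * k⁻¹ * k     ≡⟨ solve 3 (λ d k t → d :- d :* t :* k := d :- d :* (k :* t)) refl d k k⁻¹ ⟩
      d - d * (k * k⁻¹)   ≡⟨ cong (λ z → d - z) (times-unit kk⁻¹≡1 d) ⟩
      d - d               ≡⟨ solve 1 (λ d → d :- d := # 0) refl d ⟩
      0#                  ∎

    unique : ∀ μ → d - μ * k ≡ 0# → μ ≡ d * k⁻¹
    unique μ d-μk≡0 = begin
      μ                        ≡⟨ sym (times-unit kk⁻¹≡1 μ) ⟩
      μ * (k * k⁻¹)            ≡⟨ solve 4 (λ d μ k t → μ :* (k :* t) := d :* t :- (d :- μ :* k) :* t) refl d μ k k⁻¹ ⟩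
      d * k⁻¹ - (d - μ * k) * k⁻¹  ≡⟨ cong (λ z → d * k⁻¹ - z * k⁻¹) d-μk≡0 ⟩
      d * k⁻¹ - 0# * k⁻¹       ≡⟨ solve 2 (λ d t → d :* t :- # 0 :* t := d :* t) refl d k⁻¹ ⟩
      d * k⁻¹                  ∎

module BinaryQuadraticForm {q : ℕ} (F : FiniteField q)
  (two≢0 : FieldFacts.two F ≢ FiniteField.0# F) where
  open FiniteField F
  open FieldSolver F
  open FieldFacts F

  form : (a e c x y : Carrier) → Carrier
  form a e c x y = a * x * x + e * x * y + c * y * y

  disc : (a e c : Carrier) → Carrier
  disc a e c = e * e - two * two * a * c

  NonZeroPair : Carrier → Carrier → Set
  NonZeroPair x y = x ≢ 0# ⊎ y ≢ 0#

  Proportional : (x y x' y' : Carrier) → Set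
  Proportional x y x' y' = ∃[ k ] (x ≡ k * x' × y ≡ k * y')

  Root : (a e c x y : Carrier) → Set
  Root a e c x y = NonZeroPair x y × form a e c x y ≡ 0#

  UniqueRoot : (a e c : Carrier) → Set
  UniqueRoot a e c =
    ∃[ x ] ∃[ y ] (Root a e c x y × (∀ x' y' → Root a e c x' y' → Proportional x' y' x y))

  -- For a ≠ 0
  -- the root is (-e , 2a), by completing the square; for a = 0 also e = 0, so
  -- the form is c Y² with c ≠ 0 and the root is (1 , 0).
  disc-zero⇒unique-root : ∀ a e c x₀ y₀ → form a e c x₀ y₀ ≢ 0# → disc a e c ≡ 0# →
                          UniqueRoot a e c
  disc-zero⇒unique-root a e c x₀ y₀ nonzero-value Δ≡0 with a ≟ 0#
  ... | no a≢0 = - e , two * a , (inj₂ 2a≢0 , root) , on-root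
    where
    open ≡-Reasoning
    2a≢0 : two * a ≢ 0#
    2a≢0 = product-nonzero two≢0 a≢0

    root : form a e c (- e) (two * a) ≡ 0#
    root = begin
      form a e c (- e) (two * a)  ≡⟨ solve 3 (λ a e c → a :* (:- e) :* (:- e) :+ e :* (:- e) :* (# 2 :* a) :+ c :* (# 2 :* a) :* (# 2 :* a)
                                                     := :- (a :* (e :* e :- # 2 :* # 2 :* a :* c))) refl a e c ⟩
      - (a * disc a e c)          ≡⟨ cong (λ d → - (a * d)) Δ≡0 ⟩
      - (a * 0#)                  ≡⟨ solve 1 (λ a → :- (a :* # 0) := # 0) refl a ⟩
      0#                          ∎

    -- (2ax + ey)² = 4a·form(x,y) + Δ y², so every zero satisfies 2ax + ey = 0
    tangent-line : ∀ x y → form a e c x y ≡ 0# → two * a * x + e * y ≡ 0#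
    tangent-line x y form≡0 = square-zero (begin
      (two * a * x + e * y) * (two * a * x + e * y)
        ≡⟨ solve 5 (λ a e c x y → (# 2 :* a :* x :+ e :* y) :* (# 2 :* a :* x :+ e :* y)
                   := # 2 :* # 2 :* a :* (a :* x :* x :+ e :* x :* y :+ c :* y :* y) :+ (e :* e :- # 2 :* # 2 :* a :* c) :* y :* y)
                   refl a e c x y ⟩
      two * two * a * form a e c x y + disc a e c * y * y
        ≡⟨ cong₂ (λ f d → two * two * a * f + d * y * y) form≡0 Δ≡0 ⟩
      two * two * a * 0# + 0# * y * y
        ≡⟨ solve 2 (λ a y → # 2 :* # 2 :* a :* # 0 :+ # 0 :* y :* y := # 0) refl a y ⟩
      0# ∎)

    on-root : ∀ x y → Root a e c x y → Proportional x y (- e) (two * a)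
    on-root x y (_ , form≡0) with inverse (two * a) 2a≢0
    ... | t , 2at≡1 = y * t , x≡ , y≡
      where
      x≡ : x ≡ y * t * (- e)
      x≡ = begin
        x                                   ≡⟨ sym (times-unit 2at≡1 x) ⟩
        x * (two * a * t)                   ≡⟨ solve 5 (λ a e x y t → x :* (# 2 :* a :* t) := (# 2 :* a :* x :+ e :* y) :* t :+ y :* t :* (:- e)) refl a e x y t ⟩
        (two * a * x + e * y) * t + y * t * (- e)  ≡⟨ cong (λ z → z * t + y * t * (- e)) (tangent-line x y form≡0) ⟩
        0# * t + y * t * (- e)              ≡⟨ solve 3 (λ e y t → # 0 :* t :+ y :* t :* (:- e) := y :* t :* (:- e)) refl e y t ⟩
        y * t * (- e)                       ∎
      y≡ : y ≡ y * t * (two * a)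
      y≡ = begin
        y                  ≡⟨ sym (times-unit 2at≡1 y) ⟩
        y * (two * a * t)  ≡⟨ solve 3 (λ a y t → y :* (# 2 :* a :* t) := y :* t :* (# 2 :* a)) refl a y t ⟩
        y * t * (two * a)  ∎
  ... | yes refl = 1# , 0# , (inj₁ (λ 1≡0 → 0≢1 (sym 1≡0)) , root) , on-root
    where
    open ≡-Reasoning
    e≡0 : e ≡ 0#
    e≡0 = square-zero (trans (solve 2 (λ e c → e :* e := e :* e :- # 2 :* # 2 :* # 0 :* c) refl e c) Δ≡0)

    form≡cY² : ∀ x y → form 0# e c x y ≡ c * (y * y)
    form≡cY² x y = begin
      form 0# e c x y  ≡⟨ cong (λ e → form 0# e c x y) e≡0 ⟩
      form 0# 0# c x y ≡⟨ solve 3 (λ c x y → # 0 :* x :* x :+ # 0 :* x :* y :+ c :* y :* y := c :* (y :* y)) refl c x y ⟩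
      c * (y * y)      ∎

    c≢0 : c ≢ 0#
    c≢0 c≡0 = nonzero-value (trans (form≡cY² x₀ y₀) (trans (cong (_* (y₀ * y₀)) c≡0) (solve 1 (λ y → # 0 :* (y :* y) := # 0) refl y₀)))

    root : form 0# e c 1# 0# ≡ 0#
    root = trans (form≡cY² 1# 0#) (solve 1 (λ c → c :* (# 0 :* # 0) := # 0) refl c)

    on-root : ∀ x y → Root 0# e c x y → Proportional x y 1# 0#
    on-root x y (_ , form≡0) = x , solve 1 (λ x → x := x :* # 1) refl x , y≡
      where
      y≡ : y ≡ x * 0#
      y≡ with zero-product (trans (sym (form≡cY² x y)) form≡0)
      ... | inj₁ c≡0  = ⊥-elim (c≢0 c≡0)
      ... | inj₂ yy≡0 = trans (square-zero yy≡0) (solve 1 (λ x → # 0 := x :* # 0) refl x)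

  det : (x y x' y' : Carrier) → Carrier
  det x y x' y' = x * y' - y * x'

  proportional⇒det-zero : ∀ x y x' y' → Proportional x y x' y' → det x y x' y' ≡ 0#
  proportional⇒det-zero _ _ x' y' (k , refl , refl) =
    solve 3 (λ k x y → k :* x :* y :- k :* y :* x := # 0) refl k x' y'

  -- If every zero of the form has vanishing determinant against (x , y) with
  -- x ≠ 0, then Δ = 0: the zero (cx , -(ex + cy)) gives x (ex + 2cy) = 0,
  -- and Δ x² = (ex + 2cy)² - 4c·form(x,y).
  all-zeros-proportional⇒disc-zero : ∀ a e c x y → x ≢ 0# → form a e c x y ≡ 0# →
    (∀ x' y' → form a e c x' y' ≡ 0# → det x' y' x y ≡ 0#) → disc a e c ≡ 0#
  all-zeros-proportional⇒disc-zero a e c x y x≢0 form≡0 zeros-proportional = cancel-factor Δx²≡0 (product-nonzero x≢0 x≢0)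
    where
    open ≡-Reasoning
    other-zero : form a e c (c * x) (- (e * x + c * y)) ≡ 0#
    other-zero = begin
      form a e c (c * x) (- (e * x + c * y))
        ≡⟨ solve 5 (λ a e c x y → a :* (c :* x) :* (c :* x) :+ e :* (c :* x) :* (:- (e :* x :+ c :* y)) :+ c :* (:- (e :* x :+ c :* y)) :* (:- (e :* x :+ c :* y))
                   := c :* c :* (a :* x :* x :+ e :* x :* y :+ c :* y :* y)) refl a e c x y ⟩
      c * c * form a e c x y  ≡⟨ cong (c * c *_) form≡0 ⟩
      c * c * 0#              ≡⟨ solve 1 (λ c → c :* c :* # 0 := # 0) refl c ⟩
      0#                      ∎

    polar≡0 : e * x + two * c * y ≡ 0#
    polar≡0 = cancel-factor (begin
      (e * x + two * c * y) * x  ≡⟨ solve 4 (λ e c x y → (e :* x :+ # 2 :* c :* y) :* x := c :* x :* y :- (:- (e :* x :+ c :* y)) :* x) refl e c x y ⟩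
      det (c * x) (- (e * x + c * y)) x y  ≡⟨ zeros-proportional _ _ other-zero ⟩
      0#                         ∎) x≢0

    Δx²≡0 : disc a e c * (x * x) ≡ 0#
    Δx²≡0 = begin
      disc a e c * (x * x)
        ≡⟨ solve 5 (λ a e c x y → (e :* e :- # 2 :* # 2 :* a :* c) :* (x :* x)
                   := (e :* x :+ # 2 :* c :* y) :* (e :* x :+ # 2 :* c :* y) :- # 2 :* # 2 :* c :* (a :* x :* x :+ e :* x :* y :+ c :* y :* y)) refl a e c x y ⟩
      (e * x + two * c * y) * (e * x + two * c * y) - two * two * c * form a e c x y
        ≡⟨ cong₂ (λ p f → p * p - two * two * c * f) polar≡0 form≡0 ⟩
      0# * 0# - two * two * c * 0#
        ≡⟨ solve 1 (λ c → # 0 :* # 0 :- # 2 :* # 2 :* c :* # 0 := # 0) refl c ⟩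
      0# ∎

  unique-root-det-zero : ∀ a e c x y → (∀ x' y' → Root a e c x' y' → Proportional x' y' x y) →
                         ∀ x' y' → form a e c x' y' ≡ 0# → det x' y' x y ≡ 0#
  unique-root-det-zero a e c x y on-root x' y' form≡0 with x' ≟ 0# | y' ≟ 0#
  ... | no x'≢0  | _       = proportional⇒det-zero x' y' x y (on-root x' y' (inj₁ x'≢0 , form≡0))
  ... | yes _    | no y'≢0 = proportional⇒det-zero x' y' x y (on-root x' y' (inj₂ y'≢0 , form≡0))
  ... | yes refl | yes refl = solve 2 (λ x y → # 0 :* y :- # 0 :* x := # 0) refl x y

  -- exactly one projective root ⇒ Δ = 0; a root with nonzero second coordinate
  -- is handled by exchanging the roles of X and Y
  unique-root⇒disc-zero : ∀ a e c → UniqueRoot a e c → disc a e c ≡ 0#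
  unique-root⇒disc-zero a e c (x , y , (inj₁ x≢0 , form≡0) , on-root) =
    all-zeros-proportional⇒disc-zero a e c x y x≢0 form≡0 (unique-root-det-zero a e c x y on-root)
  unique-root⇒disc-zero a e c (x , y , (inj₂ y≢0 , form≡0) , on-root) = begin
    disc a e c  ≡⟨ solve 3 (λ a e c → e :* e :- # 2 :* # 2 :* a :* c := e :* e :- # 2 :* # 2 :* c :* a) refl a e c ⟩
    disc c e a  ≡⟨ all-zeros-proportional⇒disc-zero c e a y x y≢0 (trans (swap y x) form≡0) swapped-zeros-proportional ⟩
    0#          ∎
    where
    open ≡-Reasoning
    swap : ∀ x y → form c e a x y ≡ form a e c y x
    swap = solve 5 (λ a e c x y → c :* x :* x :+ e :* x :* y :+ a :* y :* y := a :* y :* y :+ e :* y :* x :+ c :* x :* x) refl a e c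
    swapped-zeros-proportional : ∀ x' y' → form c e a x' y' ≡ 0# → det x' y' y x ≡ 0#
    swapped-zeros-proportional x' y' form≡0 = begin
      det x' y' y x     ≡⟨ solve 4 (λ x y x' y' → x' :* x :- y' :* y := :- (y' :* y :- x' :* x)) refl x y x' y' ⟩
      - det y' x' x y   ≡⟨ cong -_ (unique-root-det-zero a e c x y on-root y' x' (trans (sym (swap x' y')) form≡0)) ⟩
      - 0#              ≡⟨ solve 0 (:- # 0 := # 0) refl ⟩
      0#                ∎

module Quadrics {q : ℕ} (F : FiniteField q) where
  open FiniteField F
  open PG3 F
  open FieldSolver F
  open FieldFacts F

  X₁ X₂ X₃ X₄ : Fin 4
  X₁ = zero
  X₂ = suc zero
  X₃ = suc (suc zero)
  X₄ = suc (suc (suc zero))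

  quadric : Carrier → Vec4 → Carrier
  quadric λ' p = p X₁ * p X₃ - p X₂ * p X₂ + λ' * p X₄ * p X₄

  quadric-cong : ∀ λ' {p w} → (∀ i → p i ≡ w i) → quadric λ' p ≡ quadric λ' w
  quadric-cong λ' p≗w rewrite p≗w X₁ | p≗w X₂ | p≗w X₃ | p≗w X₄ = refl

  quadric-on-π : ∀ λ' w → w X₄ ≡ 0# → quadric λ' w ≡ w X₁ * w X₃ - w X₂ * w X₂
  quadric-on-π λ' w w₄≡0 = begin
    quadric λ' w                                ≡⟨ cong (λ z → w X₁ * w X₃ - w X₂ * w X₂ + λ' * z * z) w₄≡0 ⟩
    w X₁ * w X₃ - w X₂ * w X₂ + λ' * 0# * 0#    ≡⟨ solve 4 (λ l a b c → a :* c :- b :* b :+ l :* # 0 :* # 0 := a :* c :- b :* b) refl λ' (w X₁) (w X₂) (w X₃) ⟩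
    w X₁ * w X₃ - w X₂ * w X₂                   ∎
    where open ≡-Reasoning

  -- a nonzero point with X₄ = 0 and X₁ X₃ = X₂² lies on the conic C:
  -- it is ∼ (1 , t , t² , 0) with t = X₂ / X₁ if X₁ ≠ 0, and ∼ U₃ otherwise
  conic-point : ∀ w → NonZero w → w X₄ ≡ 0# → w X₁ * w X₃ ≡ w X₂ * w X₂ → InC w
  conic-point w nonzero w₄≡0 w₁w₃≡w₂² with w X₁ ≟ 0#
  ... | yes w₁≡0 = inj₂ (w X₃ , w₃≢0 , coordinate)
    where
    w₂≡0 : w X₂ ≡ 0#
    w₂≡0 = square-zero (trans (sym w₁w₃≡w₂²) (trans (cong (_* w X₃) w₁≡0) (solve 1 (λ x → # 0 :* x := # 0) refl (w X₃))))

    w₃≢0 : w X₃ ≢ 0#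
    w₃≢0 w₃≡0 = no-nonzero-coordinate nonzero
      where
      no-nonzero-coordinate : NonZero w → ⊥
      no-nonzero-coordinate (zero , w₁≢0)                 = w₁≢0 w₁≡0
      no-nonzero-coordinate (suc zero , w₂≢0)             = w₂≢0 w₂≡0
      no-nonzero-coordinate (suc (suc zero) , w₃≢0)       = w₃≢0 w₃≡0
      no-nonzero-coordinate (suc (suc (suc zero)) , w₄≢0) = w₄≢0 w₄≡0

    coordinate : ∀ j → w j ≡ w X₃ * U3 j
    coordinate zero                   = trans w₁≡0 (solve 1 (λ x → # 0 := x :* # 0) refl (w X₃))
    coordinate (suc zero)             = trans w₂≡0 (solve 1 (λ x → # 0 := x :* # 0) refl (w X₃))
    coordinate (suc (suc zero))       = solve 1 (λ x → x := x :* # 1) refl (w X₃)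
    coordinate (suc (suc (suc zero))) = trans w₄≡0 (solve 1 (λ x → # 0 := x :* # 0) refl (w X₃))

  ... | no w₁≢0 with inverse (w X₁) w₁≢0
  ... | s , w₁s≡1 = inj₁ (w X₂ * s , w X₁ , w₁≢0 , coordinate)
    where
    open ≡-Reasoning
    coordinate : ∀ j → w j ≡ w X₁ * vec 1# (w X₂ * s) (w X₂ * s * (w X₂ * s)) 0# j
    coordinate zero = solve 1 (λ x → x := x :* # 1) refl (w X₁)
    coordinate (suc zero) = begin
      w X₂                  ≡⟨ sym (times-unit w₁s≡1 (w X₂)) ⟩
      w X₂ * (w X₁ * s)     ≡⟨ solve 3 (λ a b s → b :* (a :* s) := a :* (b :* s)) refl (w X₁) (w X₂) s ⟩
      w X₁ * (w X₂ * s)     ∎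
    coordinate (suc (suc zero)) = begin
      w X₃                                   ≡⟨ sym (times-unit w₁s≡1 (w X₃)) ⟩
      w X₃ * (w X₁ * s)                      ≡⟨ sym (times-unit w₁s≡1 _) ⟩
      w X₃ * (w X₁ * s) * (w X₁ * s)         ≡⟨ solve 3 (λ a c s → c :* (a :* s) :* (a :* s) := (a :* c) :* s :* (a :* s)) refl (w X₁) (w X₃) s ⟩
      (w X₁ * w X₃) * s * (w X₁ * s)         ≡⟨ cong (λ z → z * s * (w X₁ * s)) w₁w₃≡w₂² ⟩
      (w X₂ * w X₂) * s * (w X₁ * s)         ≡⟨ solve 3 (λ a b s → b :* b :* s :* (a :* s) := a :* (b :* s :* (b :* s))) refl (w X₁) (w X₂) s ⟩
      w X₁ * (w X₂ * s * (w X₂ * s))         ∎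
    coordinate (suc (suc (suc zero))) = trans w₄≡0 (solve 1 (λ x → # 0 := x :* # 0) refl (w X₁))

-- Its points are the
-- vectors x u + y v with (x , y) ≠ 0, taken up to proportionality, and Q_λ
-- restricts to the binary form A(λ) x² + E(λ) xy + C(λ) y² on ℓ.
module Line {q : ℕ} (F : FiniteField q) (two≢0 : FieldFacts.two F ≢ FiniteField.0# F)
  (u v : PG3.Vec4 F) (independent : PG3.LinIndep F u v) where
  open FiniteField F
  open PG3 F
  open FieldSolver F
  open FieldFacts F
  open BinaryQuadraticForm F two≢0
  open Quadrics F
  open import Data.Fin.Properties using (¬∀⟶∃¬)

  point : Carrier → Carrier → Vec4
  point x y i = x * u i + y * v i

  point-nonzero : ∀ x y → NonZeroPair x y → NonZero (point x y)
  point-nonzero x y xy≢0 = ¬∀⟶∃¬ 4 (λ i → point x y i ≡ 0#) (λ i → point x y i ≟ 0#) not-all-zero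
    where
    not-all-zero : ¬ (∀ i → point x y i ≡ 0#)
    not-all-zero all-zero = contradict xy≢0 (independent x y all-zero)
      where
      contradict : NonZeroPair x y → x ≡ 0# × y ≡ 0# → ⊥
      contradict (inj₁ x≢0) (x≡0 , _) = x≢0 x≡0
      contradict (inj₂ y≢0) (_ , y≡0) = y≢0 y≡0

  coordinates-nonzero : ∀ p x y → NonZero p → (∀ i → p i ≡ point x y i) → NonZeroPair x y
  coordinates-nonzero p x y (j , pⱼ≢0) p≗xy with x ≟ 0# | y ≟ 0#
  ... | no x≢0   | _        = inj₁ x≢0
  ... | yes _    | no y≢0   = inj₂ y≢0
  ... | yes refl | yes refl = ⊥-elim (pⱼ≢0 (trans (p≗xy j) (solve 2 (λ a b → # 0 :* a :+ # 0 :* b := # 0) refl (u j) (v j))))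

  on-line : ∀ x y → NonZeroPair x y → OnLine u v (point x y)
  on-line x y xy≢0 = point-nonzero x y xy≢0 , x , y , λ _ → refl

  ∼⇒proportional : ∀ r w x y x' y' → (∀ i → r i ≡ point x y i) → (∀ i → w i ≡ point x' y' i) →
                   r ∼ w → Proportional x y x' y'
  ∼⇒proportional r w x y x' y' r≗xy w≗x'y' (k , _ , r≗kw)
    with independent (x - k * x') (y - k * y') combination-zero
    where
    combination-zero : ∀ i → (x - k * x') * u i + (y - k * y') * v i ≡ 0#
    combination-zero i = begin
      (x - k * x') * u i + (y - k * y') * v i  ≡⟨ solve 7 (λ x y x' y' k a b → (x :- k :* x') :* a :+ (y :- k :* y') :* b
                                                   := (x :* a :+ y :* b) :- k :* (x' :* a :+ y' :* b)) refl x y x' y' k (u i) (v i) ⟩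
      point x y i - k * point x' y' i          ≡⟨ cong₂ (λ s t → s - k * t) (sym (r≗xy i)) (sym (w≗x'y' i)) ⟩
      r i - k * w i                            ≡⟨ cong (λ s → s - k * w i) (r≗kw i) ⟩
      k * w i - k * w i                        ≡⟨ solve 1 (λ z → z :- z := # 0) refl (k * w i) ⟩
      0#                                       ∎
      where open ≡-Reasoning
  ... | x-kx'≡0 , y-ky'≡0 = k , difference-zero x-kx'≡0 , difference-zero y-ky'≡0

  proportional⇒∼ : ∀ r x y x' y' → NonZero r → (∀ i → r i ≡ point x y i) →
                   Proportional x y x' y' → r ∼ point x' y'
  proportional⇒∼ r x y x' y' (j , rⱼ≢0) r≗xy (k , x≡kx' , y≡ky') = k , k≢0 , r≗k[x'y']
    where
    r≗k[x'y'] : ∀ i → r i ≡ k * point x' y' i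
    r≗k[x'y'] i = begin
      r i                         ≡⟨ r≗xy i ⟩
      x * u i + y * v i           ≡⟨ cong₂ (λ s t → s * u i + t * v i) x≡kx' y≡ky' ⟩
      k * x' * u i + k * y' * v i ≡⟨ solve 5 (λ k x y a b → k :* x :* a :+ k :* y :* b := k :* (x :* a :+ y :* b)) refl k x' y' (u i) (v i) ⟩
      k * point x' y' i           ∎
      where open ≡-Reasoning
    k≢0 : k ≢ 0#
    k≢0 k≡0 = rⱼ≢0 (trans (r≗k[x'y'] j) (trans (cong (_* point x' y' j) k≡0) (solve 1 (λ z → # 0 :* z := # 0) refl (point x' y' j))))

  A E C : Carrier → Carrier
  A λ' = quadric λ' u
  C λ' = quadric λ' v
  E λ' = u X₁ * v X₃ + u X₃ * v X₁ - two * (u X₂ * v X₂) + two * λ' * u X₄ * v X₄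

  Δ : Carrier → Carrier
  Δ λ' = disc (A λ') (E λ') (C λ')

  restriction : ∀ λ' x y → quadric λ' (point x y) ≡ form (A λ') (E λ') (C λ') x y
  restriction λ' x y = solve 11 (λ l x y u₁ u₂ u₃ u₄ v₁ v₂ v₃ v₄ →
      (x :* u₁ :+ y :* v₁) :* (x :* u₃ :+ y :* v₃) :- (x :* u₂ :+ y :* v₂) :* (x :* u₂ :+ y :* v₂)
        :+ l :* (x :* u₄ :+ y :* v₄) :* (x :* u₄ :+ y :* v₄)
      := (u₁ :* u₃ :- u₂ :* u₂ :+ l :* u₄ :* u₄) :* x :* x
         :+ (u₁ :* v₃ :+ u₃ :* v₁ :- # 2 :* (u₂ :* v₂) :+ # 2 :* l :* u₄ :* v₄) :* x :* y
         :+ (v₁ :* v₃ :- v₂ :* v₂ :+ l :* v₄ :* v₄) :* y :* y) refl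
    λ' x y (u X₁) (u X₂) (u X₃) (u X₄) (v X₁) (v X₂) (v X₃) (v X₄)

  on-quadric : ∀ λ' r x y → (∀ i → r i ≡ point x y i) → quadric λ' r ≡ form (A λ') (E λ') (C λ') x y
  on-quadric λ' r x y r≗xy = trans (quadric-cong λ' r≗xy) (restriction λ' x y)

  tangent⇒unique-root : ∀ λ' → Tangent λ' u v → UniqueRoot (A λ') (E λ') (C λ')
  tangent⇒unique-root λ' (_ , p , (p≢0 , x , y , p≗xy) , p∈Q , only-p) =
    x , y , (coordinates-nonzero p x y p≢0 p≗xy , trans (sym (on-quadric λ' p x y p≗xy)) p∈Q) , on-root
    where
    on-root : ∀ x' y' → Root (A λ') (E λ') (C λ') x' y' → Proportional x' y' x y
    on-root x' y' (x'y'≢0 , x'y'-zero) =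
      ∼⇒proportional (point x' y') p x' y' x y (λ _ → refl) p≗xy
        (only-p (point x' y') (on-line x' y' x'y'≢0) (trans (restriction λ' x' y') x'y'-zero))

  unique-root⇒tangent : ∀ λ' x₀ y₀ → NonZeroPair x₀ y₀ → form (A λ') (E λ') (C λ') x₀ y₀ ≢ 0# →
                        UniqueRoot (A λ') (E λ') (C λ') → Tangent λ' u v
  unique-root⇒tangent λ' x₀ y₀ x₀y₀≢0 off-quadric (x , y , (xy≢0 , xy-zero) , on-root) =
    (point x₀ y₀ , on-line x₀ y₀ x₀y₀≢0 , λ p∈Q → off-quadric (trans (sym (restriction λ' x₀ y₀)) p∈Q)) ,
    (point x y , on-line x y xy≢0 , trans (restriction λ' x y) xy-zero , only)
    where
    only : ∀ r → OnLine u v r → InQ λ' r → r ∼ point x y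
    only r (r≢0 , x' , y' , r≗x'y') r∈Q = proportional⇒∼ r x' y' x y r≢0 r≗x'y'
      (on-root x' y' (coordinates-nonzero r x' y' r≢0 r≗x'y' , trans (sym (on-quadric λ' r x' y' r≗x'y')) r∈Q))

  -- the point P = v₄ u - u₄ v, which is where ℓ meets the plane π
  P : Vec4
  P = point (v X₄) (- u X₄)

  P∈π : P X₄ ≡ 0#
  P∈π = solve 2 (λ a b → b :* a :+ (:- a) :* b := # 0) refl (u X₄) (v X₄)

  not-in-π⇒P-coordinates : NotInπ u v → NonZeroPair (v X₄) (- u X₄)
  not-in-π⇒P-coordinates (p , (_ , a , b , p≗ab) , p₄≢0) with v X₄ ≟ 0# | u X₄ ≟ 0#
  ... | no v₄≢0 | _       = inj₁ v₄≢0
  ... | yes _   | no u₄≢0 = inj₂ (negation-nonzero u₄≢0)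
  ... | yes v₄≡0 | yes u₄≡0 = ⊥-elim (p₄≢0 (trans (p≗ab X₄) (trans (cong₂ (λ s t → a * s + b * t) u₄≡0 v₄≡0)
                                      (solve 2 (λ a b → a :* # 0 :+ b :* # 0 := # 0) refl a b))))

  value-at-P : ∀ λ' → form (A λ') (E λ') (C λ') (v X₄) (- u X₄) ≡ quadric 0# P
  value-at-P λ' = begin
    form (A λ') (E λ') (C λ') (v X₄) (- u X₄)  ≡⟨ sym (restriction λ' (v X₄) (- u X₄)) ⟩
    quadric λ' P                               ≡⟨ quadric-on-π λ' P P∈π ⟩
    P X₁ * P X₃ - P X₂ * P X₂                  ≡⟨ sym (quadric-on-π 0# P P∈π) ⟩
    quadric 0# P                               ∎
    where open ≡-Reasoning

  discriminant : ∀ λ' → Δ λ' ≡ Δ 0# - λ' * (two * two * quadric 0# P)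
  discriminant λ' = solve 9 (λ l u₁ u₂ u₃ u₄ v₁ v₂ v₃ v₄ →
      let A' = λ l → u₁ :* u₃ :- u₂ :* u₂ :+ l :* u₄ :* u₄
          C' = λ l → v₁ :* v₃ :- v₂ :* v₂ :+ l :* v₄ :* v₄
          E' = λ l → u₁ :* v₃ :+ u₃ :* v₁ :- # 2 :* (u₂ :* v₂) :+ # 2 :* l :* u₄ :* v₄
          Δ' = λ l → E' l :* E' l :- # 2 :* # 2 :* A' l :* C' l
          p₁ = v₄ :* u₁ :+ (:- u₄) :* v₁
          p₂ = v₄ :* u₂ :+ (:- u₄) :* v₂
          p₃ = v₄ :* u₃ :+ (:- u₄) :* v₃
          p₄ = v₄ :* u₄ :+ (:- u₄) :* v₄
      in Δ' l := Δ' (# 0) :- l :* (# 2 :* # 2 :* (p₁ :* p₃ :- p₂ :* p₂ :+ # 0 :* p₄ :* p₄))) refl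
    λ' (u X₁) (u X₂) (u X₃) (u X₄) (v X₁) (v X₂) (v X₃) (v X₄)

lemma3 : (q : ℕ) → (F : FiniteField q) →
           (∃[ p ] ∃[ k ] (Prime p × ¬ (2 ∣ p) × q ≡ p Data.Nat.^ k)) →
           let open FiniteField F
               open PG3 F
           in ∀ (u v : Vec4) → NonZero u → NonZero v → LinIndep u v →
              NotInπ u v → MissesC u v →
              ∃[ λ' ] (Tangent λ' u v × (∀ μ → Tangent μ u v → μ ≡ λ'))
lemma3 q F (p , k , _ , 2∤p , q≡p^k) u v _ _ independent not-in-π misses-C = λ* , tangent-at-λ* , only-λ*
  where
  open FiniteField F
  open PG3 F
  open FieldFacts F

  two≢0 : two ≢ 0#
  two≢0 = odd-order⇒two≢0 (λ 2∣q → Parity.odd-power p k 2∤p (subst (2 ∣_) q≡p^k 2∣q))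

  open BinaryQuadraticForm F two≢0
  open Quadrics F
  open Line F two≢0 u v independent

  P-coordinates : NonZeroPair (v X₄) (- u X₄)
  P-coordinates = not-in-π⇒P-coordinates not-in-π

  -- P ∈ π ∖ C, so Q(P) ≠ 0
  Q[P]≢0 : quadric 0# P ≢ 0#
  Q[P]≢0 Q[P]≡0 = misses-C P (on-line _ _ P-coordinates)
    (conic-point P (point-nonzero _ _ P-coordinates) P∈π (difference-zero (trans (sym (quadric-on-π 0# P P∈π)) Q[P]≡0)))

  P-off-quadric : ∀ λ' → form (A λ') (E λ') (C λ') (v X₄) (- u X₄) ≢ 0#
  P-off-quadric λ' value≡0 = Q[P]≢0 (trans (sym (value-at-P λ')) value≡0)

  root : ∃[ λ' ] (Δ 0# - λ' * (two * two * quadric 0# P) ≡ 0# ×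
                  (∀ μ → Δ 0# - μ * (two * two * quadric 0# P) ≡ 0# → μ ≡ λ'))
  root = affine-unique-solution (Δ 0#) (two * two * quadric 0# P)
           (product-nonzero (product-nonzero two≢0 two≢0) Q[P]≢0)
  λ* : Carrier
  λ* = proj₁ root

  tangent-at-λ* : Tangent λ* u v
  tangent-at-λ* = unique-root⇒tangent λ* _ _ P-coordinates (P-off-quadric λ*)
    (disc-zero⇒unique-root _ _ _ _ _ (P-off-quadric λ*) (trans (discriminant λ*) (proj₁ (proj₂ root))))

  only-λ* : ∀ μ → Tangent μ u v → μ ≡ λ*
  only-λ* μ tangent = proj₂ (proj₂ root) μ
    (trans (sym (discriminant μ)) (unique-root⇒disc-zero _ _ _ (tangent⇒unique-root μ tangent)))
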